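{- Let $k$ be a positive integer with $a=k+1\ge3$ odd, and define $f:\{0,1,\ldots,a-1\}\to\{ -1,1\}$ by $f(j)=-1$ if $j<\frac{a-3}{2}$ and $f(j)=1$ if $j\ge\frac{a-3}{2}$. Then: (1) the number of $j$ with $f(j)=1$ is $\frac{a+3}{2}$ and the number with $f(j)=-1$ is $\frac{a-3}{2}$; (2) if $A\subseteq\mathbb Z$ is an $a$-term arithmetic progression and $S$ is the multiset of residues modulo $a$ (in $\{0,\ldots,a-1\}$) of its terms, then $\left|\sum_{j\in S}f(j)\right|\ge3$, the sum counting multiplicity; (3) if $B\subseteq\mathbb Z$ is a $k$-term arithmetic progression and $T$ is the multiset of residues modulo $a$ of its terms, then $\sum_{j\in T}f(j)\ne0$, the sum counting multiplicity. -}

module Defs where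

open import Data.Nat as ℕ using (ℕ; suc; _<ᵇ_; _∸_)
open import Data.Integer as ℤ using (ℤ; +_; -_; _%ℕ_)
open import Data.Bool using (if_then_else_)
open import Data.List using (List; map; upTo; filter; length)
import Data.List as List
open import Relation.Binary.PropositionalEquality using (_≡_)

-- f_a(j) = -1 if j < (a-3)/2, and 1 otherwise.
-- For odd a ≥ 3, (a-3)/2 is an integer and j < (a-3)/2  ⇔  2j < a-3.
f : (a : ℕ) → ℕ → ℤ
f a j = if (2 ℕ.* j) <ᵇ (a ∸ 3) then - (+ 1) else + 1

count : (a : ℕ) → ℤ → ℕ
count a v = length (filter (λ j → f a j ℤ.≟ v) (upTo a))

apTerms : ℤ → ℤ → ℕ → List ℤ
apTerms x d n = map (λ i → x ℤ.+ (+ i) ℤ.* d) (upTo n)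

residueSum : (k : ℕ) → List ℤ → ℤ
residueSum k ts = List.foldr ℤ._+_ (+ 0) (map (λ t → f (suc k) (t %ℕ suc k)) ts)

-- Write a = 2m + 3, so that f(j) = -1 exactly when j < m; part (1) is then a count.
-- For an a-term progression with difference d let g = gcd(a, |d|). If g = 1 the a residues are
-- distinct, so at most m of them lie below m and the sum is at least a - 2m = 3. Otherwise the
-- residues repeat with period p = a/g, so the sum is g times a sum of p signs; p is odd, so that
-- sum is nonzero, and g ≥ 3 as an odd divisor of a other than 1. For (3), extending a k-term
-- progression by one term changes its sum by ±1, so by (2) it cannot have been 0.
module Submission where

open import Data.Nat.Base using (ℕ; NonZero)
open import Data.Integer.Base using (ℤ)

module Sum where

  open import Data.Nat as ℕ using (ℕ; zero; suc)
  open import Data.Integer using (ℤ; +_; _+_; _*_)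
  open import Data.Integer.Properties using (+-comm; +-assoc; +-identityˡ; *-identityˡ; *-distribʳ-+)
  open import Data.List using (map; applyUpTo; foldr)
  open import Function using (_∘_)
  open import Relation.Binary.PropositionalEquality

  sumTo : (ℕ → ℤ) → ℕ → ℤ
  sumTo s zero    = + 0
  sumTo s (suc n) = s 0 + sumTo (s ∘ suc) n

  foldr-+-map-applyUpTo : ∀ {A : Set} (s : A → ℤ) (h : ℕ → A) n →
    foldr _+_ (+ 0) (map s (applyUpTo h n)) ≡ sumTo (s ∘ h) n
  foldr-+-map-applyUpTo s h zero    = refl
  foldr-+-map-applyUpTo s h (suc n) = cong (_+_ (s (h 0))) (foldr-+-map-applyUpTo s (h ∘ suc) n)

  sumTo-cong : ∀ {s t : ℕ → ℤ} → (∀ i → s i ≡ t i) → ∀ n → sumTo s n ≡ sumTo t n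
  sumTo-cong s≗t zero    = refl
  sumTo-cong s≗t (suc n) = cong₂ _+_ (s≗t 0) (sumTo-cong (s≗t ∘ suc) n)

  sumTo-+ : ∀ s p n → sumTo s (p ℕ.+ n) ≡ sumTo s p + sumTo (s ∘ (p ℕ.+_)) n
  sumTo-+ s zero    n = sym (+-identityˡ (sumTo s n))
  sumTo-+ s (suc p) n = trans (cong (_+_ (s 0)) (sumTo-+ (s ∘ suc) p n)) (sym (+-assoc (s 0) _ _))

  sumTo-suc : ∀ s n → sumTo s (suc n) ≡ sumTo s n + s n
  sumTo-suc s zero    = +-comm (s 0) (+ 0)
  sumTo-suc s (suc n) = trans (cong (_+_ (s 0)) (sumTo-suc (s ∘ suc) n)) (sym (+-assoc (s 0) _ _))

  sumTo-periodic : ∀ s p → (∀ i → s (p ℕ.+ i) ≡ s i) →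
    ∀ g → sumTo s (g ℕ.* p) ≡ + g * sumTo s p
  sumTo-periodic s p periodic zero    = refl
  sumTo-periodic s p periodic (suc g) = begin
    sumTo s (p ℕ.+ g ℕ.* p)                  ≡⟨ sumTo-+ s p (g ℕ.* p) ⟩
    T + sumTo (s ∘ (p ℕ.+_)) (g ℕ.* p)       ≡⟨ cong (_+_ T) (sumTo-cong periodic (g ℕ.* p)) ⟩
    T + sumTo s (g ℕ.* p)                    ≡⟨ cong (_+_ T) (sumTo-periodic s p periodic g) ⟩
    T + + g * T                              ≡⟨ cong (_+ + g * T) (*-identityˡ T) ⟨
    + 1 * T + + g * T                        ≡⟨ *-distribʳ-+ T (+ 1) (+ g) ⟨
    + suc g * T                              ∎
    where
    open ≡-Reasoning
    T = sumTo s p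

module Count where

  open import Data.Nat using (ℕ; zero; suc; _+_; _≤_; _<_; z≤n; s≤s; z<s; s<s; _≟_; _<?_)
  open import Data.Nat.Properties
    using (≤-trans; ≤-reflexive; +-mono-≤; +-comm; +-assoc; suc-injective; 1+n≢0; m<1+n⇒m<n∨m≡n;
           +-commutativeSemigroup)
  open import Algebra.Properties.CommutativeSemigroup +-commutativeSemigroup using (interchange)
  open import Data.List using (applyUpTo; filter; length)
  open import Data.Sum using (_⊎_; inj₁; inj₂)
  open import Function using (_∘_)
  open import Level using (Level)
  open import Relation.Nullary using (Dec; yes; no; ¬_; contradiction)
  open import Relation.Unary using (Pred; Decidable)
  open import Relation.Binary.PropositionalEquality

  private variable
    ℓ : Level
    A B C : Set ℓ
    P Q R : Pred ℕ ℓ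

  indicator : Dec A → ℕ
  indicator (yes _) = 1
  indicator (no _)  = 0

  indicator-∪ : (A → B ⊎ C) → (A? : Dec A) (B? : Dec B) (C? : Dec C) →
    indicator A? ≤ indicator B? + indicator C?
  indicator-∪ _   (no _)  _       _       = z≤n
  indicator-∪ _   (yes _) (yes _) _       = s≤s z≤n
  indicator-∪ _   (yes _) (no _)  (yes _) = s≤s z≤n
  indicator-∪ A⇒B∪C (yes a) (no ¬b) (no ¬c) with A⇒B∪C a
  ... | inj₁ b = contradiction b ¬b
  ... | inj₂ c = contradiction c ¬c

  countTo : Decidable P → ℕ → ℕ
  countTo P? zero    = 0
  countTo P? (suc n) = indicator (P? 0) + countTo (P? ∘ suc) n

  length-filter-applyUpTo : ∀ {A : Set} {P : Pred A ℓ} (P? : Decidable P) h n →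
    length (filter P? (applyUpTo h n)) ≡ countTo (P? ∘ h) n
  length-filter-applyUpTo P? h zero = refl
  length-filter-applyUpTo P? h (suc n) with P? (h 0)
  ... | yes _ = cong suc (length-filter-applyUpTo P? (h ∘ suc) n)
  ... | no _  = length-filter-applyUpTo P? (h ∘ suc) n

  countTo-+ : ∀ (P? : Decidable P) p n → countTo P? (p + n) ≡ countTo P? p + countTo (P? ∘ (p +_)) n
  countTo-+ P? zero    n = refl
  countTo-+ P? (suc p) n = trans (cong (indicator (P? 0) +_) (countTo-+ (P? ∘ suc) p n))
                                 (sym (+-assoc (indicator (P? 0)) _ _))

  countTo-none : ∀ (P? : Decidable P) n → (∀ i → i < n → ¬ P i) → countTo P? n ≡ 0
  countTo-none P? zero    _    = refl
  countTo-none P? (suc n) none with P? 0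
  ... | yes p = contradiction p (none 0 z<s)
  ... | no _  = countTo-none (P? ∘ suc) n (λ i i<n → none (suc i) (s<s i<n))

  countTo-all : ∀ (P? : Decidable P) n → (∀ i → i < n → P i) → countTo P? n ≡ n
  countTo-all P? zero    _   = refl
  countTo-all P? (suc n) all with P? 0
  ... | yes _ = cong suc (countTo-all (P? ∘ suc) n (λ i i<n → all (suc i) (s<s i<n)))
  ... | no ¬p = contradiction (all 0 z<s) ¬p

  countTo-∪ : ∀ (P? : Decidable P) (Q? : Decidable Q) (R? : Decidable R) n →
    (∀ i → i < n → P i → Q i ⊎ R i) → countTo P? n ≤ countTo Q? n + countTo R? n
  countTo-∪ P? Q? R? zero    _     = z≤n
  countTo-∪ P? Q? R? (suc n) P⇒Q∪R = ≤-trans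
    (+-mono-≤ (indicator-∪ (P⇒Q∪R 0 z<s) (P? 0) (Q? 0) (R? 0))
              (countTo-∪ (P? ∘ suc) (Q? ∘ suc) (R? ∘ suc) n (λ i i<n → P⇒Q∪R (suc i) (s<s i<n))))
    (≤-reflexive (interchange (indicator (Q? 0)) (indicator (R? 0)) _ _))

  InjectiveBelow : ℕ → (ℕ → ℕ) → Set
  InjectiveBelow n r = ∀ {i j} → i < n → j < n → r i ≡ r j → i ≡ j

  InjectiveBelow-suc : ∀ {n r} → InjectiveBelow (suc n) r → InjectiveBelow n (r ∘ suc)
  InjectiveBelow-suc inj i<n j<n eq = suc-injective (inj (s<s i<n) (s<s j<n) eq)

  countTo-fibre≤1 : ∀ n {r} → InjectiveBelow n r → ∀ v → countTo (λ i → r i ≟ v) n ≤ 1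
  countTo-fibre≤1 zero    inj v = z≤n
  countTo-fibre≤1 (suc n) {r} inj v with r 0 ≟ v
  ... | yes r0≡v = s≤s (≤-reflexive (countTo-none (λ i → r (suc i) ≟ v) n
                     λ i i<n ri≡v → 1+n≢0 (inj (s<s i<n) z<s (trans ri≡v (sym r0≡v)))))
  ... | no _ = countTo-fibre≤1 n (InjectiveBelow-suc inj) v

  countTo-below≤ : ∀ n {r} → InjectiveBelow n r → ∀ w → countTo (λ i → r i <? w) n ≤ w
  countTo-below≤ n {r} inj zero = ≤-reflexive (countTo-none (λ i → r i <? 0) n (λ _ _ ()))
  countTo-below≤ n {r} inj (suc w) = ≤-trans
    (countTo-∪ (λ i → r i <? suc w) (λ i → r i <? w) (λ i → r i ≟ w) n (λ _ _ → m<1+n⇒m<n∨m≡n))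
    (≤-trans (+-mono-≤ (countTo-below≤ n inj w) (countTo-fibre≤1 n inj w)) (≤-reflexive (+-comm w 1)))

module Sign where

  open Sum
  open Count
  open import Data.Bool using (if_then_else_)
  open import Data.Nat as ℕ using (ℕ; zero; suc; _∸_; z≤n)
  open import Data.Nat.Properties as ℕ
    using (≤-total; *-suc; m≤n⇒m∸n≡0; ∸-monoʳ-≤; *-monoʳ-≤; ≤-trans; ≤-reflexive)
  open import Data.Nat.Divisibility using (_∣_; m∣m*n)
  open import Data.Integer using (ℤ; +_; ∣_∣; _+_; _-_; _⊖_; 1ℤ; -1ℤ)
  open import Data.Integer.Properties using (+-assoc; +-injective; ⊖-≥; [+m]-[+n]≡m⊖n)
  open import Data.Integer.Tactic.RingSolver using (solve-∀)
  open import Data.Sum using (inj₁; inj₂)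
  open import Function using (_∘_)
  open import Level using (Level)
  open import Relation.Nullary using (Dec; yes; no; does; ¬_; contradiction)
  open import Relation.Unary using (Pred; Decidable)
  open import Relation.Binary.PropositionalEquality

  private variable
    ℓ : Level
    A : Set ℓ
    P : Pred ℕ ℓ

  signOf : Dec A → ℤ
  signOf A? = if does A? then -1ℤ else 1ℤ

  signOf-yes : (A? : Dec A) → A → signOf A? ≡ -1ℤ
  signOf-yes (yes _) _ = refl
  signOf-yes (no ¬a) a = contradiction a ¬a

  signOf-no : (A? : Dec A) → ¬ A → signOf A? ≡ 1ℤ
  signOf-no (yes a) ¬a = contradiction a ¬a
  signOf-no (no _)  _  = refl

  ∣signOf∣≡1 : (A? : Dec A) → ∣ signOf A? ∣ ≡ 1
  ∣signOf∣≡1 (yes _) = refl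
  ∣signOf∣≡1 (no _)  = refl

  sumTo-signOf : ∀ (P? : Decidable P) n → sumTo (signOf ∘ P?) n + + (2 ℕ.* countTo P? n) ≡ + n
  sumTo-signOf P? zero = refl
  sumTo-signOf P? (suc n) with P? 0 | sumTo-signOf (P? ∘ suc) n
  ... | yes _ | ih = begin
    (-1ℤ + S) + + (2 ℕ.* suc c)       ≡⟨ cong (λ t → (-1ℤ + S) + + t) (*-suc 2 c) ⟩
    (-1ℤ + S) + (+ 2 + + (2 ℕ.* c))   ≡⟨ regroup S (+ (2 ℕ.* c)) ⟩
    1ℤ + (S + + (2 ℕ.* c))            ≡⟨ cong (_+_ 1ℤ) ih ⟩
    + suc n                            ∎
    where
    open ≡-Reasoning
    S = sumTo (signOf ∘ P? ∘ suc) n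
    c = countTo (P? ∘ suc) n
    regroup : ∀ (S C : ℤ) → (-1ℤ + S) + (+ 2 + C) ≡ 1ℤ + (S + C)
    regroup = solve-∀
  ... | no _ | ih = trans (+-assoc 1ℤ (sumTo (signOf ∘ P? ∘ suc) n) _) (cong (_+_ 1ℤ) ih)

  sumTo-signOf-odd≢0 : ∀ (P? : Decidable P) n → ¬ 2 ∣ n → sumTo (signOf ∘ P?) n ≢ + 0
  sumTo-signOf-odd≢0 P? n 2∤n S≡0 = 2∤n (subst (2 ∣_) 2c≡n (m∣m*n (countTo P? n)))
    where
    2c≡n : 2 ℕ.* countTo P? n ≡ n
    2c≡n = +-injective (trans (cong (_+ + (2 ℕ.* countTo P? n)) (sym S≡0)) (sumTo-signOf P? n))

  m∸n≤∣m⊖n∣ : ∀ m n → m ∸ n ℕ.≤ ∣ m ⊖ n ∣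
  m∸n≤∣m⊖n∣ m n with ≤-total n m
  ... | inj₁ n≤m = ≤-reflexive (sym (cong ∣_∣ (⊖-≥ n≤m)))
  ... | inj₂ m≤n = ≤-trans (≤-reflexive (m≤n⇒m∸n≡0 m≤n)) z≤n

  sumTo-signOf-≥ : ∀ (P? : Decidable P) n c → countTo P? n ℕ.≤ c →
    n ∸ 2 ℕ.* c ℕ.≤ ∣ sumTo (signOf ∘ P?) n ∣
  sumTo-signOf-≥ P? n c L≤c = begin
    n ∸ 2 ℕ.* c       ≤⟨ ∸-monoʳ-≤ n (*-monoʳ-≤ 2 L≤c) ⟩
    n ∸ 2 ℕ.* L       ≤⟨ m∸n≤∣m⊖n∣ n (2 ℕ.* L) ⟩
    ∣ n ⊖ 2 ℕ.* L ∣   ≡⟨ cong ∣_∣ S≡n⊖2L ⟨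
    ∣ S ∣             ∎
    where
    open ℕ.≤-Reasoning
    L = countTo P? n
    S = sumTo (signOf ∘ P?) n
    cancel : ∀ (S X : ℤ) → S ≡ (S + X) - X
    cancel = solve-∀
    S≡n⊖2L : S ≡ n ⊖ 2 ℕ.* L
    S≡n⊖2L = trans (cancel S (+ (2 ℕ.* L)))
               (trans (cong (_- + (2 ℕ.* L)) (sumTo-signOf P? n)) ([+m]-[+n]≡m⊖n n (2 ℕ.* L)))

module Residue {a : ℕ} .{{_ : NonZero a}} where

  open import Data.Nat as ℕ using (ℕ; zero; suc; _<_)
  open import Data.Nat.Properties using (≤-<-trans; ⊔-pres-<m)
  open import Data.Nat.Divisibility using (>⇒∤)
  import Data.Nat.Divisibility as ℕ
  open import Data.Integer using (ℤ; +_; _+_; _-_; _*_; ∣_∣; _%ℕ_; _/ℕ_; 0ℤ)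
  open import Data.Integer.Properties
    using (+-injective; i-j≡0⇒i≡j; ∣i∣≡0⇒i≡0; ∣m⊝n∣≤m⊔n; [+m]-[+n]≡m⊖n;
           +-inverseʳ; +-identityˡ)
  open import Data.Integer.DivMod using (n%ℕd<d; a≡a%ℕn+[a/ℕn]*n)
  open import Data.Integer.Divisibility.Signed
    using (_∣_; divides; ∣⇒∣ᵤ; ∣m+n∣n⇒∣m; ∣n⇒∣m*n; ∣-refl)
  open import Data.Integer.Tactic.RingSolver using (solve-∀)
  open import Relation.Nullary using (contradiction)
  open import Relation.Binary.PropositionalEquality

  ∣∧<⇒≡0 : ∀ {t} → a ℕ.∣ t → t < a → t ≡ 0
  ∣∧<⇒≡0 {zero}  _   _   = refl
  ∣∧<⇒≡0 {suc t} a∣t t<a = contradiction a∣t (>⇒∤ t<a)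

  ∣[m-n]⇒m≡n : ∀ {m n} → m < a → n < a → + a ∣ + m - + n → m ≡ n
  ∣[m-n]⇒m≡n {m} {n} m<a n<a a∣m-n =
    +-injective (i-j≡0⇒i≡j (+ m) (+ n) (∣i∣≡0⇒i≡0 (∣∧<⇒≡0 (∣⇒∣ᵤ a∣m-n) ∣m-n∣<a)))
    where
    ∣m-n∣<a : ∣ + m - + n ∣ < a
    ∣m-n∣<a = subst (_< a) (cong ∣_∣ (sym ([+m]-[+n]≡m⊖n m n)))
                (≤-<-trans (∣m⊝n∣≤m⊔n m n) (⊔-pres-<m m<a n<a))

  u-v≡[u%a-v%a]+[u/a-v/a]*a : ∀ u v →
    u - v ≡ (+ (u %ℕ a) - + (v %ℕ a)) + (u /ℕ a - v /ℕ a) * + a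
  u-v≡[u%a-v%a]+[u/a-v/a]*a u v =
    trans (cong₂ _-_ (a≡a%ℕn+[a/ℕn]*n u a) (a≡a%ℕn+[a/ℕn]*n v a))
          (regroup (+ (u %ℕ a)) (+ (v %ℕ a)) (u /ℕ a) (v /ℕ a) (+ a))
    where
    regroup : ∀ (r s q t A : ℤ) → (r + q * A) - (s + t * A) ≡ (r - s) + (q - t) * A
    regroup = solve-∀

  %ℕ-≡⇒∣- : ∀ u v → u %ℕ a ≡ v %ℕ a → + a ∣ u - v
  %ℕ-≡⇒∣- u v u≡v = divides q (begin
    u - v                                          ≡⟨ u-v≡[u%a-v%a]+[u/a-v/a]*a u v ⟩
    (+ (u %ℕ a) - + (v %ℕ a)) + q * + a            ≡⟨ cong (λ r → (+ r - + (v %ℕ a)) + q * + a) u≡v ⟩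
    (+ (v %ℕ a) - + (v %ℕ a)) + q * + a            ≡⟨ cong (_+ q * + a) (+-inverseʳ (+ (v %ℕ a))) ⟩
    0ℤ + q * + a                                   ≡⟨ +-identityˡ (q * + a) ⟩
    q * + a                                        ∎)
    where
    open ≡-Reasoning
    q = u /ℕ a - v /ℕ a

  ∣-⇒%ℕ-≡ : ∀ u v → + a ∣ u - v → u %ℕ a ≡ v %ℕ a
  ∣-⇒%ℕ-≡ u v a∣u-v = ∣[m-n]⇒m≡n (n%ℕd<d u a) (n%ℕd<d v a)
    (∣m+n∣n⇒∣m (subst (+ a ∣_) (u-v≡[u%a-v%a]+[u/a-v/a]*a u v) a∣u-v)
               (∣n⇒∣m*n (u /ℕ a - v /ℕ a) ∣-refl))

module ArithmeticProgression {a : ℕ} .{{_ : NonZero a}} (x d : ℤ) where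

  open Residue {a}
  open Count using (InjectiveBelow)
  open import Data.Nat as ℕ using (ℕ)
  open import Data.Integer using (ℤ; +_; _+_; _-_; _*_; _%ℕ_)
  open import Data.Integer.Properties using (pos-+)
  open import Data.Integer.Coprimality using (Coprime; coprime-divisor)
  open import Data.Integer.Divisibility.Signed using (_∣_; ∣⇒∣ᵤ; ∣ᵤ⇒∣)
  open import Data.Integer.Tactic.RingSolver using (solve-∀)
  open import Relation.Binary.PropositionalEquality

  term : ℕ → ℤ
  term i = x + + i * d

  residue : ℕ → ℕ
  residue i = term i %ℕ a

  term-difference : ∀ i j → term i - term j ≡ d * (+ i - + j)
  term-difference i j = factor x (+ i) (+ j) d
    where
    factor : ∀ (x i j d : ℤ) → (x + i * d) - (x + j * d) ≡ d * (i - j)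
    factor = solve-∀

  residue-injective : Coprime (+ a) d → InjectiveBelow a residue
  residue-injective coprime {i} {j} i<a j<a ri≡rj = ∣[m-n]⇒m≡n i<a j<a
    (∣ᵤ⇒∣ (coprime-divisor (+ a) d (+ i - + j) coprime
      (∣⇒∣ᵤ (subst (+ a ∣_) (term-difference i j) (%ℕ-≡⇒∣- (term i) (term j) ri≡rj)))))

  residue-periodic : ∀ p → + a ∣ + p * d → ∀ i → residue (p ℕ.+ i) ≡ residue i
  residue-periodic p a∣pd i = ∣-⇒%ℕ-≡ (term (p ℕ.+ i)) (term i) (subst (+ a ∣_) pd≡ a∣pd)
    where
    cancel : ∀ (p i d : ℤ) → p * d ≡ d * ((p + i) - i)
    cancel = solve-∀
    pd≡ : + p * d ≡ term (p ℕ.+ i) - term i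
    pd≡ = trans (cancel (+ p) (+ i) d)
                (sym (trans (term-difference (p ℕ.+ i) i) (cong (λ t → d * (t - + i)) (pos-+ p i))))

module Divisor where

  open import Data.Nat as ℕ using (ℕ; suc; _≤_; z≤n; s≤s)
  open import Data.Nat.Properties using (m≤m*n)
  open import Data.Nat.Divisibility using (_∣_; 0∣⇒≡0)
  open import Data.Integer using (+_; _*_; ∣_∣; 0ℤ; ≢-nonZero)
  open import Data.Integer.Properties using (abs-*)
  open import Relation.Nullary using (¬_; contradiction)
  open import Relation.Binary.PropositionalEquality

  odd-divisor≢1⇒≥3 : ∀ {n g} .{{_ : NonZero n}} → ¬ 2 ∣ n → g ∣ n → g ≢ 1 → 3 ≤ g
  odd-divisor≢1⇒≥3 {n} {0} _   0∣n _   = contradiction (0∣⇒≡0 0∣n) (ℕ.≢-nonZero⁻¹ n)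
  odd-divisor≢1⇒≥3 {g = 1} _   _   1≢1 = contradiction refl 1≢1
  odd-divisor≢1⇒≥3 {g = 2} 2∤n 2∣n _   = contradiction 2∣n 2∤n
  odd-divisor≢1⇒≥3 {g = suc (suc (suc _))} _ _ _ = s≤s (s≤s (s≤s z≤n))

  n≤∣+n*i∣ : ∀ n {i} → i ≢ 0ℤ → n ≤ ∣ + n * i ∣
  n≤∣+n*i∣ n {i} i≢0 = subst (n ≤_) (sym (abs-* (+ n) i)) (m≤m*n n ∣ i ∣ {{≢-nonZero i≢0}})

module OddModulus (m : ℕ) where

  open Sum
  open Count
  open Sign
  open Divisor
  open import Defs
  open import Data.Bool using (if_then_else_)
  open import Data.Nat as ℕ using (ℕ; _+_; _*_; _∸_; _/_; _%_; _<_; _≤_; _<?_; s≤s)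
  open import Data.Nat.Properties
    using (*-comm; *-cancelˡ-<; *-monoʳ-<; +-identityʳ; m+n≮m; m+n∸n≡m; 0≢1+n; module ≤-Reasoning)
  open import Data.Nat.DivMod using (m*n/n≡m; [m+kn]%n≡m%n)
  open import Data.Nat.Divisibility using (_∣_; divides; ∣-trans; n∣m⇒m%n≡0)
  open import Data.Nat.GCD using (gcd; gcd[m,n]∣m; gcd[m,n]∣n)
  open import Data.Nat.Coprimality using (gcd≡1⇒coprime)
  open import Data.Nat.Tactic.RingSolver using (solve-∀)
  open import Data.Integer as ℤ using (ℤ; +_; ∣_∣; _%ℕ_; 0ℤ; 1ℤ; -1ℤ)
  open import Data.Integer.Coprimality using (Coprime)
  open import Data.Integer.Divisibility.Signed as ℤ using (∣ᵤ⇒∣)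
  open import Data.Integer.Properties using (pos-*; +-identityˡ)
  open import Data.List using (map; foldr)
  open import Data.List.Properties using (map-upTo)
  open import Function using (_∘_; id; mk⇔)
  open import Relation.Nullary using (¬_; yes; no; contradiction)
  open import Relation.Nullary.Decidable using (does-⇔)
  open import Relation.Binary.PropositionalEquality

  a : ℕ
  a = 3 + 2 * m

  f≡signOf : ∀ j → f a j ≡ signOf (j <? m)
  f≡signOf j = cong (λ b → if b then -1ℤ else 1ℤ)
    (does-⇔ (mk⇔ (*-cancelˡ-< 2 j m) (*-monoʳ-< 2)) (2 * j <? 2 * m) (j <? m))

  f-below : ∀ {j} → j < m → f a j ≡ -1ℤ
  f-below {j} j<m = trans (f≡signOf j) (signOf-yes (j <? m) j<m)

  f-above : ∀ i → f a (m + i) ≡ 1ℤ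
  f-above i = trans (f≡signOf (m + i)) (signOf-no (m + i <? m) (m+n≮m m i))

  count-split : ∀ v →
    count a v ≡ countTo (λ j → f a j ℤ.≟ v) m + countTo (λ i → f a (m + i) ℤ.≟ v) (3 + m)
  count-split v = trans (length-filter-applyUpTo P? id a)
                        (trans (cong (countTo P?) (a≡m+[3+m] m)) (countTo-+ P? m (3 + m)))
    where
    P? = λ j → f a j ℤ.≟ v
    a≡m+[3+m] : ∀ m → 3 + 2 * m ≡ m + (3 + m)
    a≡m+[3+m] = solve-∀

  count-plus : count a 1ℤ ≡ (a + 3) / 2
  count-plus = begin
    count a 1ℤ       ≡⟨ count-split 1ℤ ⟩
    _                ≡⟨ cong₂ _+_ (countTo-none (λ j → f a j ℤ.≟ 1ℤ) m below)
                                  (countTo-all (λ i → f a (m + i) ℤ.≟ 1ℤ) (3 + m) λ i _ → f-above i) ⟩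
    3 + m            ≡⟨ m*n/n≡m (3 + m) 2 ⟨
    (3 + m) * 2 / 2  ≡⟨ cong (_/ 2) (a+3≡[3+m]*2 m) ⟨
    (a + 3) / 2      ∎
    where
    open ≡-Reasoning
    below : ∀ j → j < m → f a j ≢ 1ℤ
    below _ j<m = subst (_≢ 1ℤ) (sym (f-below j<m)) λ ()
    a+3≡[3+m]*2 : ∀ m → (3 + 2 * m) + 3 ≡ (3 + m) * 2
    a+3≡[3+m]*2 = solve-∀

  count-minus : count a -1ℤ ≡ (a ∸ 3) / 2
  count-minus = begin
    count a -1ℤ  ≡⟨ count-split -1ℤ ⟩
    _            ≡⟨ cong₂ _+_ (countTo-all (λ j → f a j ℤ.≟ -1ℤ) m λ _ → f-below)
                              (countTo-none (λ i → f a (m + i) ℤ.≟ -1ℤ) (3 + m) above) ⟩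
    m + 0        ≡⟨ +-identityʳ m ⟩
    m            ≡⟨ m*n/n≡m m 2 ⟨
    m * 2 / 2    ≡⟨ cong (_/ 2) (*-comm m 2) ⟩
    (a ∸ 3) / 2  ∎
    where
    open ≡-Reasoning
    above : ∀ i → i < 3 + m → f a (m + i) ≢ -1ℤ
    above i _ = subst (_≢ -1ℤ) (sym (f-above i)) λ ()

  2∤a : ¬ 2 ∣ a
  2∤a 2∣a = 0≢1+n (trans (sym (n∣m⇒m%n≡0 a 2 2∣a)) a%2≡1)
    where
    a%2≡1 : a % 2 ≡ 1
    a%2≡1 = trans (cong (λ t → (3 + t) % 2) (*-comm 2 m)) ([m+kn]%n≡m%n 3 m 2)

  module _ (x d : ℤ) where

    open ArithmeticProgression {a} x d

    summand : ℕ → ℤ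
    summand i = f a (residue i)

    summand≡signOf : ∀ i → summand i ≡ signOf (residue i <? m)
    summand≡signOf i = f≡signOf (residue i)

    residueSum≡sumTo : ∀ n → residueSum (2 + 2 * m) (apTerms x d n) ≡ sumTo summand n
    residueSum≡sumTo n = trans (cong (foldr ℤ._+_ 0ℤ ∘ map (λ t → f a (t %ℕ a))) (map-upTo term n))
                               (foldr-+-map-applyUpTo (λ t → f a (t %ℕ a)) term n)

    coprime-bound : Coprime (+ a) d → 3 ≤ ∣ sumTo summand a ∣
    coprime-bound coprime = begin
      3                                             ≡⟨ m+n∸n≡m 3 (2 * m) ⟨
      a ∸ 2 * m                                     ≤⟨ sumTo-signOf-≥ (λ i → residue i <? m) a m
                                                         (countTo-below≤ a (residue-injective coprime) m) ⟩
      ∣ sumTo (λ i → signOf (residue i <? m)) a ∣   ≡⟨ cong ∣_∣ (sumTo-cong summand≡signOf a) ⟨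
      ∣ sumTo summand a ∣                           ∎
      where open ≤-Reasoning

    periodic-bound : ∀ {g} → g ∣ a → g ∣ ∣ d ∣ → g ≢ 1 → 3 ≤ ∣ sumTo summand a ∣
    periodic-bound {g} g∣a@(divides p a≡pg) g∣d g≢1 = begin
      3                            ≤⟨ odd-divisor≢1⇒≥3 2∤a g∣a g≢1 ⟩
      g                            ≤⟨ n≤∣+n*i∣ g T≢0 ⟩
      ∣ + g ℤ.* T ∣                ≡⟨ cong ∣_∣ (sumTo-periodic summand p periodic g) ⟨
      ∣ sumTo summand (g * p) ∣    ≡⟨ cong (∣_∣ ∘ sumTo summand) (trans (*-comm g p) (sym a≡pg)) ⟩
      ∣ sumTo summand a ∣          ∎
      where
      open ≤-Reasoning
      T = sumTo summand p
      a∣pd : + a ℤ.∣ + p ℤ.* d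
      a∣pd = subst (ℤ._∣ + p ℤ.* d) (sym (trans (cong +_ a≡pg) (pos-* p g)))
                   (ℤ.*-monoʳ-∣ (+ p) (∣ᵤ⇒∣ g∣d))
      periodic : ∀ i → summand (p + i) ≡ summand i
      periodic i = cong (f a) (residue-periodic p a∣pd i)
      2∤p : ¬ 2 ∣ p
      2∤p 2∣p = 2∤a (∣-trans 2∣p (divides g (trans a≡pg (*-comm p g))))
      T≢0 : T ≢ 0ℤ
      T≢0 = sumTo-signOf-odd≢0 (λ i → residue i <? m) p 2∤p ∘ trans (sym (sumTo-cong summand≡signOf p))

    full-sum-bound : 3 ≤ ∣ sumTo summand a ∣
    full-sum-bound with gcd a ∣ d ∣ ℕ.≟ 1
    ... | yes g≡1 = coprime-bound (gcd≡1⇒coprime g≡1)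
    ... | no  g≢1 = periodic-bound (gcd[m,n]∣m a ∣ d ∣) (gcd[m,n]∣n a ∣ d ∣) g≢1

    short-sum≢0 : sumTo summand (2 + 2 * m) ≢ 0ℤ
    short-sum≢0 S≡0 = contradiction (subst (3 ≤_) ∣full-sum∣≡1 full-sum-bound) λ { (s≤s ()) }
      where
      k = 2 + 2 * m
      open ≡-Reasoning
      ∣full-sum∣≡1 : ∣ sumTo summand a ∣ ≡ 1
      ∣full-sum∣≡1 = begin
        ∣ sumTo summand a ∣                  ≡⟨ cong ∣_∣ (sumTo-suc summand k) ⟩
        ∣ sumTo summand k ℤ.+ summand k ∣    ≡⟨ cong (λ t → ∣ t ℤ.+ summand k ∣) S≡0 ⟩
        ∣ 0ℤ ℤ.+ summand k ∣                 ≡⟨ cong ∣_∣ (+-identityˡ (summand k)) ⟩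
        ∣ summand k ∣                        ≡⟨ cong ∣_∣ (summand≡signOf k) ⟩
        ∣ signOf (residue k <? m) ∣          ≡⟨ ∣signOf∣≡1 (residue k <? m) ⟩
        1                                    ∎

open import Defs
open import Data.Nat using (ℕ; suc; _≤_; _+_; _∸_; _/_; _%_; _*_; zero; s≤s)
open import Data.Nat.Properties using (*-comm)
open import Data.Nat.DivMod using (m≡m%n+[m/n]*n)
open import Data.Integer using (ℤ; +_; -_; ∣_∣)
open import Data.Product using (_×_; _,_; ∃-syntax)
open import Relation.Nullary using (contradiction)
open import Relation.Binary.PropositionalEquality using (_≡_; _≢_; refl; sym; trans; cong; subst)
open import Function using (_∘_)

odd≥3⇒≡3+2m : ∀ n → 3 ≤ n → n % 2 ≡ 1 → ∃[ m ] n ≡ 3 + 2 * m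
odd≥3⇒≡3+2m n 3≤n n%2≡1 =
  from-quotient (n / 2) (trans (m≡m%n+[m/n]*n n 2) (cong (_+ (n / 2) * 2) n%2≡1))
  where
  from-quotient : ∀ q → n ≡ 1 + q * 2 → ∃[ m ] n ≡ 3 + 2 * m
  from-quotient zero    n≡1 = contradiction (subst (3 ≤_) n≡1 3≤n) λ { (s≤s ()) }
  from-quotient (suc m) n≡  = m , trans n≡ (cong (_+_ 3) (*-comm m 2))

lemma3p8 : (k : ℕ) → 1 ≤ k → 3 ≤ suc k → suc k % 2 ≡ 1 →
    ((count (suc k) (+ 1) ≡ (suc k + 3) / 2) × (count (suc k) (- (+ 1)) ≡ (suc k ∸ 3) / 2))
    × ((x d : ℤ) → d ≢ + 0 → 3 ≤ ∣ residueSum k (apTerms x d (suc k)) ∣)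
    × ((x d : ℤ) → d ≢ + 0 → residueSum k (apTerms x d k) ≢ + 0)
lemma3p8 k _ 3≤a a-odd with odd≥3⇒≡3+2m (suc k) 3≤a a-odd
... | m , refl =
  (count-plus , count-minus)
  , (λ x d _ → subst (λ S → 3 ≤ ∣ S ∣) (sym (residueSum≡sumTo x d a)) (full-sum-bound x d))
  , (λ x d _ → short-sum≢0 x d ∘ trans (sym (residueSum≡sumTo x d k)))
  where open OddModulus m
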